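{- Let $G\in \mathcal{GT}$ with $t=|V(G)|\geq 3$. Then $G$ is a subgraph of some member of $\mathcal{GT}^{(t)}$ (necessarily on the same $t$ vertices).
   Context: The classes $\mathcal{GT}^{(t)}$ of $t$-vertex graphs are defined inductively: $\mathcal{GT}^{(2)}=\{K_2\}$; for $t>2$, each member of $\mathcal{GT}^{(t)}$ is obtained by taking some $G'\in\mathcal{GT}^{(t-1)}$, choosing an edge $xy$ of $G'$, adding a new vertex $z\notin V(G')$ and joining $z$ to both $x$ and $y$. Each member of $\mathcal{GT}^{(t)}$ has exactly $t$ vertices and $2t-3$ edges. $\mathcal{GT}$ is the family of all non-empty subgraphs of members of $\bigcup_{t\ge 2}\mathcal{GT}^{(t)}$. -}

module Defs where

open import Data.Nat using (ℕ; suc; _≥_)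
open import Data.Product using (_×_; _,_; proj₁; proj₂; Σ; ∃; ∃-syntax)
open import Data.Sum using (_⊎_)
open import Data.List using (List; []; _∷_; length)
open import Data.List.Membership.Propositional using (_∈_; _∉_)
open import Data.List.Relation.Unary.All using (All)
open import Data.List.Relation.Unary.Unique.Propositional using (Unique)
open import Relation.Binary.PropositionalEquality using (_≢_)

-- A (labelled) graph: a list of vertex labels and a list of edges.
-- Edges are unordered; (x , y) and (y , x) denote the same edge.
record Graph : Set where
  constructor graph
  field
    V : List ℕ
    E : List (ℕ × ℕ)
open Graph public

WF : Graph → Set
WF G = Unique (V G) × All (λ e → proj₁ e ∈ V G × proj₂ e ∈ V G × proj₁ e ≢ proj₂ e) (E G)

-- Number of vertices (V is duplicate-free for well-formed graphs).
∣V∣ : Graph → ℕ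
∣V∣ G = length (V G)

Adj : Graph → ℕ → ℕ → Set
Adj G x y = (x , y) ∈ E G ⊎ (y , x) ∈ E G

_⊑_ : Graph → Graph → Set
H ⊑ G = (∀ v → v ∈ V H → v ∈ V G) × (∀ x y → Adj H x y → Adj G x y)

data GTt : ℕ → Graph → Set where
  base : ∀ {x y} → x ≢ y → GTt 2 (graph (x ∷ y ∷ []) ((x , y) ∷ []))
  step : ∀ {t G x y z} → GTt t G → (x , y) ∈ E G → z ∉ V G →
         GTt (suc t) (graph (z ∷ V G) ((z , x) ∷ (z , y) ∷ E G))

InGT : Graph → Set
InGT H = WF H × (∃[ v ] v ∈ V H) × (∃[ t ] ∃[ G ] (t ≥ 2 × GTt t G × H ⊑ G))

-- Restricting a member of GT^(t) to a set S of at least two of its vertices yields a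
-- member of GT^(|S|) on S that keeps every edge inside S.  Induct on the construction:
-- when the newest vertex z lies outside S nothing changes; when it lies in S, z is
-- re-attached to an edge uw of the restricted graph that covers the S-endpoints of the
-- edge xy that z was originally attached to, so the edges zx and zy that matter survive;
-- if z is the second vertex of S, the restriction is the single edge from z to the first.
-- For H a subgraph of G in GT^(t) take S = V(H), which has |V(H)| elements.
module Submission where

open import Defs
open import Data.Nat using (ℕ; _≥_; _≤_; s≤s; z≤n; _≤?_; _≟_)
open import Data.Nat.Properties using (≤-trans)
open import Data.Product using (_×_; ∃-syntax; _,_; proj₁; proj₂)
open import Data.Sum using (_⊎_; inj₁; inj₂; swap)
open import Data.List using (List; []; _∷_; length; filter)
open import Data.List.Relation.Unary.Any using (here; there)
open import Data.List.Relation.Unary.All as All using ([]; _∷_)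
open import Data.List.Relation.Unary.All.Properties using (¬Any⇒All¬)
open import Data.List.Relation.Unary.AllPairs using ([]; _∷_)
open import Data.List.Relation.Unary.Unique.Propositional using (Unique)
open import Data.List.Relation.Unary.Unique.Propositional.Properties using (filter⁺)
open import Data.List.Membership.Propositional using (_∈_; _∉_)
open import Data.List.Membership.Propositional.Properties using (∈-filter⁺; ∈-filter⁻)
open import Data.List.Membership.Propositional.Properties.WithK using (unique∧set⇒bag)
open import Data.List.Membership.DecPropositional _≟_ using (_∈?_)
open import Data.List.Relation.Binary.BagAndSetEquality using (∼bag⇒↭)
open import Data.List.Relation.Binary.Permutation.Propositional.Properties using (↭-length)
open import Function.Bundles using (_⇔_; mk⇔; Equivalence)
open import Level using (0ℓ)
open import Relation.Unary using (Pred; Decidable)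
open import Relation.Nullary using (yes; no; ¬_; contradiction)
open import Relation.Binary.PropositionalEquality using (_≡_; _≢_; refl; sym; trans; cong; subst)

private
  variable
    t k : ℕ
    a b v x y z : ℕ
    G G′ : Graph

unique-same-elements⇒length-≡ : ∀ {xs ys : List ℕ} → Unique xs → Unique ys →
  (∀ {v} → v ∈ xs ⇔ v ∈ ys) → length xs ≡ length ys
unique-same-elements⇒length-≡ uxs uys xs≈ys = ↭-length (∼bag⇒↭ (unique∧set⇒bag uxs uys xs≈ys))

_∈ᵉ_ : ℕ → ℕ × ℕ → Set
v ∈ᵉ (x , y) = v ≡ x ⊎ v ≡ y

attach : ℕ → ℕ × ℕ → Graph → Graph
attach z (x , y) G = graph (z ∷ V G) ((z , x) ∷ (z , y) ∷ E G)

WF-Adj : WF G → Adj G a b → a ∈ V G × b ∈ V G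
WF-Adj (_ , edges) (inj₁ ab) = let a∈ , b∈ , _ = All.lookup edges ab in a∈ , b∈
WF-Adj (_ , edges) (inj₂ ba) = let b∈ , a∈ , _ = All.lookup edges ba in a∈ , b∈

GTt⇒WF : GTt t G → WF G
GTt⇒WF (base x≢y) = ((x≢y ∷ []) ∷ [] ∷ []) , (here refl , there (here refl) , x≢y) ∷ []
GTt⇒WF (step g xy z∉) =
  let uniq , edges = GTt⇒WF g
      x∈ , y∈ , _  = All.lookup edges xy
      new : ∀ {w} → w ∈ _ → _
      new w∈ = here refl , there w∈ , λ { refl → z∉ w∈ }
  in  (¬Any⇒All¬ _ z∉ ∷ uniq) ,
      new x∈ ∷ new y∈ ∷ All.map (λ (a∈ , b∈ , a≢b) → there a∈ , there b∈ , a≢b) edges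

GTt-edge : GTt t G → ∃[ e ] e ∈ E G
GTt-edge (base _)     = _ , here refl
GTt-edge (step _ _ _) = _ , here refl

GTt-incident : GTt t G → v ∈ V G → ∃[ e ] (e ∈ E G × v ∈ᵉ e)
GTt-incident (base _)     (here refl)         = _ , here refl , inj₁ refl
GTt-incident (base _)     (there (here refl)) = _ , here refl , inj₂ refl
GTt-incident (step _ _ _) (here refl)         = _ , here refl , inj₁ refl
GTt-incident (step g _ _) (there v∈)          =
  let e , e∈ , v∈e = GTt-incident g v∈ in e , there (there e∈) , v∈e

module _ {P : Pred ℕ 0ℓ} (P? : Decidable P) where

  EdgesWithin : Graph → Graph → Set
  EdgesWithin G G′ = ∀ {a b} → (a , b) ∈ E G → P a → P b → Adj G′ a b

  EdgesWithin-Adj : EdgesWithin G G′ → P a → P b → Adj G a b → Adj G′ a b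
  EdgesWithin-Adj within Pa Pb (inj₁ ab) = within ab Pa Pb
  EdgesWithin-Adj within Pa Pb (inj₂ ba) = swap (within ba Pb Pa)

  covering-edge : GTt k G′ → (∀ {v} → v ∈ᵉ (x , y) → P v → v ∈ V G′) →
    (P x → P y → Adj G′ x y) → ∃[ e ] (e ∈ E G′ × (P x → x ∈ᵉ e) × (P y → y ∈ᵉ e))
  covering-edge {x = x} {y} g′ ends∈ adj with P? x | P? y
  ... | yes Px | yes Py with adj Px Py
  ...   | inj₁ xy = _ , xy , (λ _ → inj₁ refl) , (λ _ → inj₂ refl)
  ...   | inj₂ yx = _ , yx , (λ _ → inj₂ refl) , (λ _ → inj₁ refl)
  covering-edge g′ ends∈ adj | yes Px | no ¬Py =
    let e , e∈ , x∈e = GTt-incident g′ (ends∈ (inj₁ refl) Px)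
    in  e , e∈ , (λ _ → x∈e) , (λ Py → contradiction Py ¬Py)
  covering-edge g′ ends∈ adj | no ¬Px | yes Py =
    let e , e∈ , y∈e = GTt-incident g′ (ends∈ (inj₂ refl) Py)
    in  e , e∈ , (λ Px → contradiction Px ¬Px) , (λ _ → y∈e)
  covering-edge g′ ends∈ adj | no ¬Px | no ¬Py =
    let e , e∈ = GTt-edge g′
    in  e , e∈ , (λ Px → contradiction Px ¬Px) , (λ Py → contradiction Py ¬Py)

  EdgesWithin-attach : ∀ {e} → (P x → x ∈ᵉ e) → (P y → y ∈ᵉ e) → EdgesWithin G G′ →
    EdgesWithin (attach z (x , y) G) (attach z e G′)
  EdgesWithin-attach covers-x covers-y within (here refl) _ Px with covers-x Px
  ... | inj₁ refl = inj₁ (here refl)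
  ... | inj₂ refl = inj₁ (there (here refl))
  EdgesWithin-attach covers-x covers-y within (there (here refl)) _ Py with covers-y Py
  ... | inj₁ refl = inj₁ (here refl)
  ... | inj₂ refl = inj₁ (there (here refl))
  EdgesWithin-attach covers-x covers-y within (there (there ab)) Pa Pb with within ab Pa Pb
  ... | inj₁ ab′ = inj₁ (there (there ab′))
  ... | inj₂ ba′ = inj₂ (there (there ba′))

  EdgesWithin-attach-outside : ¬ P z → EdgesWithin G G′ → EdgesWithin (attach z (x , y) G) G′
  EdgesWithin-attach-outside ¬Pz within (here refl)         Pz _ = contradiction Pz ¬Pz
  EdgesWithin-attach-outside ¬Pz within (there (here refl)) Pz _ = contradiction Pz ¬Pz
  EdgesWithin-attach-outside ¬Pz within (there (there ab))  Pa Pb = within ab Pa Pb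

  -- An old edge inside P would be a loop at a.
  EdgesWithin-attach-pendant : GTt t G → (x , y) ∈ E G → filter P? (V G) ≡ a ∷ [] →
    EdgesWithin (attach z (x , y) G) (graph (z ∷ a ∷ []) ((z , a) ∷ []))
  EdgesWithin-attach-pendant {G = G} {x = x} {y = y} {a = a} {z = z} g xy only-a = within
    where
    P-vertex≡a : v ∈ V G → P v → v ≡ a
    P-vertex≡a v∈ Pv with here v≡a ← subst (_ ∈_) only-a (∈-filter⁺ P? v∈ Pv) = v≡a

    within : EdgesWithin (attach z (x , y) G) (graph (z ∷ a ∷ []) ((z , a) ∷ []))
    within (here refl)         _  Px =
      inj₁ (here (cong (_ ,_) (P-vertex≡a (proj₁ (WF-Adj (GTt⇒WF g) (inj₁ xy))) Px)))
    within (there (here refl)) _  Py =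
      inj₁ (here (cong (_ ,_) (P-vertex≡a (proj₂ (WF-Adj (GTt⇒WF g) (inj₁ xy))) Py)))
    within (there (there ab))  Pa Pb =
      let a∈ , b∈ , a≢b = All.lookup (proj₂ (GTt⇒WF g)) ab
      in  contradiction (trans (P-vertex≡a a∈ Pa) (sym (P-vertex≡a b∈ Pb))) a≢b

  GTt-restrict : GTt t G → 2 ≤ length (filter P? (V G)) →
    ∃[ G′ ] (GTt (length (filter P? (V G))) G′ × V G′ ≡ filter P? (V G) × EdgesWithin G G′)
  GTt-restrict (base {x} {y} x≢y) h with P? x
  ... | yes _ with P? y
  ...   | yes _ = _ , base x≢y , refl , λ xy _ _ → inj₁ xy
  ...   | no _  with s≤s () ← h
  GTt-restrict (base {x} {y} x≢y) h | no _ with P? y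
  ...   | yes _ with s≤s () ← h
  ...   | no _  with () ← h
  GTt-restrict (step {G = G₀} {x} {y} {z} g xy z∉) h with P? z
  ... | no ¬Pz =
    let G₀′ , g₀′ , V≡ , within = GTt-restrict g h
    in  G₀′ , g₀′ , V≡ , EdgesWithin-attach-outside {G = G₀} {G₀′} {x = x} {y} ¬Pz within
  GTt-restrict (step {G = G₀} {x} {y} {z} g xy z∉) (s≤s h) | yes Pz
    with 2 ≤? length (filter P? (V G₀))
  ... | yes h₀ =
    let G₀′ , g₀′ , V≡ , within = GTt-restrict g h₀
        ends∈ : ∀ {v} → v ∈ᵉ _ → P v → v ∈ V G₀′
        ends∈ = λ { (inj₁ refl) Pv → subst (_ ∈_) (sym V≡) (∈-filter⁺ P? (proj₁ x∈,y∈) Pv)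
                  ; (inj₂ refl) Pv → subst (_ ∈_) (sym V≡) (∈-filter⁺ P? (proj₂ x∈,y∈) Pv) }
        e , e∈ , covers-x , covers-y = covering-edge g₀′ ends∈ (within xy)
        z∉′ : z ∉ V G₀′
        z∉′ z∈ = z∉ (proj₁ (∈-filter⁻ P? (subst (z ∈_) V≡ z∈)))
    in  attach z e G₀′ , step g₀′ e∈ z∉′ , cong (z ∷_) V≡ ,
        EdgesWithin-attach {G = G₀} {G₀′} covers-x covers-y within
    where
    x∈,y∈ : _ ∈ V G₀ × _ ∈ V G₀
    x∈,y∈ = WF-Adj (GTt⇒WF g) (inj₁ xy)
  ... | no ¬h₀ with filter P? (V G₀) in only
  ...   | []        with () ← h
  ...   | _ ∷ _ ∷ _ = contradiction (s≤s (s≤s z≤n)) ¬h₀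
  ...   | a ∷ []    =
    let z≢a : z ≢ a
        z≢a = λ { refl → z∉ (proj₁ (∈-filter⁻ P? (subst (a ∈_) (sym only) (here refl)))) }
    in  _ , base z≢a , refl , EdgesWithin-attach-pendant g xy only

lemma3p5 : (H : Graph) → InGT H → ∣V∣ H ≥ 3 →
    ∃[ G ] (GTt (∣V∣ H) G × H ⊑ G)
lemma3p5 H (wfH , _ , _ , G , _ , g , V⊆ , adj⊆) ∣V∣≥3 = conclude (GTt-restrict P? g 2≤|S|)
  where
  P? = _∈? V H
  S  = filter P? (V G)

  S⇔V : ∀ {v} → v ∈ S ⇔ v ∈ V H
  S⇔V = mk⇔ (λ v∈S → proj₂ (∈-filter⁻ P? {xs = V G} v∈S)) (λ v∈V → ∈-filter⁺ P? (V⊆ _ v∈V) v∈V)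

  |S|≡∣V∣ : length S ≡ ∣V∣ H
  |S|≡∣V∣ = unique-same-elements⇒length-≡ (filter⁺ P? (proj₁ (GTt⇒WF g))) (proj₁ wfH) S⇔V

  2≤|S| : 2 ≤ length S
  2≤|S| = subst (2 ≤_) (sym |S|≡∣V∣) (≤-trans (s≤s (s≤s z≤n)) ∣V∣≥3)

  conclude : ∃[ G′ ] (GTt (length S) G′ × V G′ ≡ S × EdgesWithin P? G G′) →
    ∃[ G′ ] (GTt (∣V∣ H) G′ × H ⊑ G′)
  conclude (G′ , g′ , V≡S , within) = G′ , subst (λ n → GTt n G′) |S|≡∣V∣ g′ , vertices , edges
    where
    vertices : ∀ v → v ∈ V H → v ∈ V G′
    vertices v v∈ = subst (v ∈_) (sym V≡S) (Equivalence.from S⇔V v∈)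

    edges : ∀ a b → Adj H a b → Adj G′ a b
    edges a b adj =
      let a∈ , b∈ = WF-Adj wfH adj in EdgesWithin-Adj P? {G = G} {G′} within a∈ b∈ (adj⊆ a b adj)
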